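{- Let $\pi\in S_n\setminus\{w_0^n\}$ and let $\rho\in S_{n+1}$ be its stabilization ($\rho(k)=\pi(k)$ for $k\leq n$, $\rho(n+1)=n+1$), so that $\pi$ and $\rho$ have the same Rothe diagram. Let $i$ be such that $i+\pi(i)\leq n$ and $\pi(c)>\pi(i)$ for all $c<i$ (i.e. $(i,\pi(i))$ lies just outside the dominant part of the Rothe diagram). Then $$\{\sigma\in S_{n+1}:\sigma\gtrdot\rho,\ \sigma(i)\neq\rho(i)\}=\{\sigma\in S_n:\sigma\gtrdot\pi,\ \sigma(i)\neq\pi(i)\},$$ where $S_n$ is viewed inside $S_{n+1}$; that is, the generalized co-transition formula for $\rho$ has no extra terms beyond those for $\pi$.
   Context: $w_0^n(k)=n+1-k$ for $k\leq n$. $\sigma\gtrdot\pi$ denotes a cover in Bruhat order: $\sigma=\pi\circ(a\leftrightarrow b)$ with $a<b$, $\pi(a)<\pi(b)$, and no $c\in(a,b)$ with $\pi(c)\in(\pi(a),\pi(b))$. The Rothe diagram of $\pi$ is $\{(a,b):\pi(a)>b,\ \pi^{ -1}(b)>a\}$; its dominant part is the set of its boxes connected to the northwest corner $(1,1)$. -}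

module Defs where

open import Data.Nat using (ℕ; suc)
import Data.Nat as ℕ
open import Data.Fin using (Fin; toℕ; fromℕ; inject₁; lower₁; _<_)
open import Data.Fin.Permutation.Components using (transpose)
open import Data.Product using (∃; ∃-syntax; _×_)
open import Relation.Binary.PropositionalEquality using (_≡_; sym)
open import Relation.Nullary using (¬_; yes; no)
open import Function using (_∘_)

-- Positions and values are 0-indexed (Fin n); a permutation is applied as a function.
-- Stabilization: ρ(k) = π(k) for k < n (0-indexed), ρ(n) = n.
stab : ∀ {n} → (Fin n → Fin n) → Fin (suc n) → Fin (suc n)
stab {n} f k with toℕ k ℕ.≟ n
... | yes _ = fromℕ n
... | no ne = inject₁ (f (lower₁ k (ne ∘ sym)))

Covers : ∀ {m} → (Fin m → Fin m) → (Fin m → Fin m) → Set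
Covers σ π = ∃[ a ] ∃[ b ] (a < b × π a < π b
  × (∀ c → a < c → c < b → ¬ (π a < π c × π c < π b))
  × (∀ k → σ k ≡ π (transpose a b k)))

-- Positions of ρ below n are those of π, so a transposition (a b) of ρ with b < n is a
-- cover of ρ exactly when it is a cover of π, and then σ is the stabilization of π ∘ (a b).
-- The only other covers swap a position a with the last one; moving i forces a = i, and then
-- the cover condition says that every position after i carries a value below π(i).  There are
-- n - i - 1 such positions but only π(i) such values, contradicting i + π(i) ≤ n (1-indexed).
module Submission where

open import Defs
open import Data.Nat using (ℕ; suc; _+_; _≤_)
open import Data.Fin using (Fin; toℕ; inject₁; opposite; _<_; _>_)
open import Data.Fin.Permutation using (Permutation′; _⟨$⟩ʳ_)
open import Data.Product using (∃; ∃-syntax; _×_)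
open import Relation.Binary.PropositionalEquality using (_≡_; _≢_)
open import Relation.Nullary using (¬_)
open import Function.Bundles using (_⇔_)

import Data.Nat as ℕ
import Data.Nat.Properties as ℕ
open import Data.Fin using (fromℕ; fromℕ<; lower₁)
open import Data.Fin.Properties
  using (_≟_; toℕ-injective; toℕ-inject₁; toℕ-inject₁-≢; toℕ-fromℕ; toℕ-fromℕ<; toℕ<n;
         fromℕ<-injective; fromℕ≢inject₁; inject₁-injective; inject₁-lower₁; lower₁-inject₁′;
         injective⇒≤; <-cmp)
import Data.Fin.Permutation as Perm
open import Data.Fin.Permutation.Components using (transpose)
open import Data.Product using (_,_)
open import Data.Sum using (_⊎_; inj₁; inj₂)
open import Relation.Nullary using (yes; no; contradiction)
open import Relation.Binary using (tri<; tri≈; tri>)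
open import Relation.Binary.PropositionalEquality
  using (_≗_; refl; sym; trans; cong; subst₂; module ≡-Reasoning)
open import Function using (_∘_)
open import Function.Bundles using (mk⇔; Injection)
open import Function.Definitions using (Injective)
open import Function.Properties.Inverse using (↔⇒↣)

private variable
  n : ℕ

⟨$⟩ʳ-injective : (π : Permutation′ n) → Injective _≡_ _≡_ (π ⟨$⟩ʳ_)
⟨$⟩ʳ-injective π = Injection.injective (↔⇒↣ π)

inject₁-or-fromℕ : (k : Fin (suc n)) → (∃ λ k′ → k ≡ inject₁ k′) ⊎ k ≡ fromℕ n
inject₁-or-fromℕ {n} k with toℕ k ℕ.≟ n
... | yes k≡n = inj₂ (toℕ-injective (trans k≡n (sym (toℕ-fromℕ n))))
... | no  k≢n = inj₁ (lower₁ k (k≢n ∘ sym) , sym (inject₁-lower₁ k (k≢n ∘ sym)))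

inject₁-mono-< : {x y : Fin n} → x < y → inject₁ x < inject₁ y
inject₁-mono-< {x = x} {y} = subst₂ ℕ._<_ (sym (toℕ-inject₁ x)) (sym (toℕ-inject₁ y))

inject₁-cancel-< : {x y : Fin n} → inject₁ x < inject₁ y → x < y
inject₁-cancel-< {x = x} {y} = subst₂ ℕ._<_ (toℕ-inject₁ x) (toℕ-inject₁ y)

inject₁<fromℕ : (x : Fin n) → inject₁ x < fromℕ n
inject₁<fromℕ {n} x = subst₂ ℕ._<_ (sym (toℕ-inject₁ x)) (sym (toℕ-fromℕ n)) (toℕ<n x)

transpose-fixes : (a b k : Fin n) → k ≢ a → k ≢ b → transpose a b k ≡ k
transpose-fixes a b k k≢a k≢b with k ≟ a
... | yes k≡a = contradiction k≡a k≢a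
... | no  _ with k ≟ b
...   | yes k≡b = contradiction k≡b k≢b
...   | no  _   = refl

transpose-map : ∀ {m} (g : Fin n → Fin m) → Injective _≡_ _≡_ g →
                ∀ a b k → transpose (g a) (g b) (g k) ≡ g (transpose a b k)
transpose-map g g-inj a b k with k ≟ a | g k ≟ g a
... | yes _   | yes _    = refl
... | yes k≡a | no  gk≢ga = contradiction (cong g k≡a) gk≢ga
... | no  k≢a | yes gk≡ga = contradiction (g-inj gk≡ga) k≢a
... | no  _   | no  _ with k ≟ b | g k ≟ g b
...   | yes _   | yes _    = refl
...   | yes k≡b | no  gk≢gb = contradiction (cong g k≡b) gk≢gb
...   | no  k≢b | yes gk≡gb = contradiction (g-inj gk≡gb) k≢b
...   | no  _   | no  _    = refl

stab-inject₁ : (f : Fin n → Fin n) (k : Fin n) → stab f (inject₁ k) ≡ inject₁ (f k)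
stab-inject₁ {n} f k with toℕ (inject₁ k) ℕ.≟ n
... | yes k≡n = contradiction (sym k≡n) (toℕ-inject₁-≢ k)
... | no  k≢n = cong (inject₁ ∘ f) (lower₁-inject₁′ k (k≢n ∘ sym))

stab-fromℕ : (f : Fin n → Fin n) → stab f (fromℕ n) ≡ fromℕ n
stab-fromℕ {n} f with toℕ (fromℕ n) ℕ.≟ n
... | yes _   = refl
... | no  k≢n = contradiction (toℕ-fromℕ n) k≢n

stab-cong : {f g : Fin n → Fin n} → f ≗ g → stab f ≗ stab g
stab-cong {f = f} {g} f≗g k with inject₁-or-fromℕ k
... | inj₁ (k′ , refl) = trans (stab-inject₁ f k′) (trans (cong inject₁ (f≗g k′)) (sym (stab-inject₁ g k′)))
... | inj₂ refl        = trans (stab-fromℕ f) (sym (stab-fromℕ g))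

stab-∘-transpose : (f : Fin n → Fin n) (a b : Fin n) →
                   stab (f ∘ transpose a b) ≗ stab f ∘ transpose (inject₁ a) (inject₁ b)
stab-∘-transpose {n} f a b k with inject₁-or-fromℕ k
... | inj₁ (k′ , refl) = begin
  stab (f ∘ transpose a b) (inject₁ k′)             ≡⟨ stab-inject₁ _ k′ ⟩
  inject₁ (f (transpose a b k′))                    ≡⟨ stab-inject₁ f _ ⟨
  stab f (inject₁ (transpose a b k′))               ≡⟨ cong (stab f) (transpose-map inject₁ inject₁-injective a b k′) ⟨
  stab f (transpose (inject₁ a) (inject₁ b) (inject₁ k′)) ∎
  where open ≡-Reasoning
... | inj₂ refl = begin
  stab (f ∘ transpose a b) (fromℕ n)             ≡⟨ stab-fromℕ _ ⟩
  fromℕ n                                        ≡⟨ stab-fromℕ f ⟨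
  stab f (fromℕ n)                               ≡⟨ cong (stab f) (transpose-fixes _ _ _ fromℕ≢inject₁ fromℕ≢inject₁) ⟨
  stab f (transpose (inject₁ a) (inject₁ b) (fromℕ n)) ∎
  where open ≡-Reasoning

stab-mono-< : (f : Fin n → Fin n) {x y : Fin n} → f x < f y → stab f (inject₁ x) < stab f (inject₁ y)
stab-mono-< f {x} {y} = subst₂ _<_ (sym (stab-inject₁ f x)) (sym (stab-inject₁ f y)) ∘ inject₁-mono-<

stab-cancel-< : (f : Fin n → Fin n) {x y : Fin n} → stab f (inject₁ x) < stab f (inject₁ y) → f x < f y
stab-cancel-< f {x} {y} = inject₁-cancel-< ∘ subst₂ _<_ (stab-inject₁ f x) (stab-inject₁ f y)

≗stab-inject₁ : {σ : Fin (suc n) → Fin (suc n)} {τ : Fin n → Fin n} →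
                σ ≗ stab τ → (k : Fin n) → σ (inject₁ k) ≡ inject₁ (τ k)
≗stab-inject₁ {τ = τ} σ≗ k = trans (σ≗ (inject₁ k)) (stab-inject₁ τ k)

IsCoverPair : ∀ {m} → (Fin m → Fin m) → Fin m → Fin m → Set
IsCoverPair f a b = a < b × f a < f b × (∀ c → a < c → c < b → ¬ (f a < f c × f c < f b))

coverPair-stab⁺ : {f : Fin n → Fin n} {a b : Fin n} →
                  IsCoverPair f a b → IsCoverPair (stab f) (inject₁ a) (inject₁ b)
coverPair-stab⁺ {f = f} {a} {b} (a<b , fa<fb , gap) = inject₁-mono-< a<b , stab-mono-< f fa<fb , gap′
  where
  gap′ : ∀ c → inject₁ a < c → c < inject₁ b → ¬ (stab f (inject₁ a) < stab f c × stab f c < stab f (inject₁ b))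
  gap′ c a<c c<b with inject₁-or-fromℕ c
  ... | inj₁ (c′ , refl) = λ (p , q) →
    gap c′ (inject₁-cancel-< a<c) (inject₁-cancel-< c<b) (stab-cancel-< f p , stab-cancel-< f q)
  ... | inj₂ refl = contradiction c<b (ℕ.<-asym (inject₁<fromℕ b))

coverPair-stab⁻ : {f : Fin n → Fin n} {a b : Fin n} →
                  IsCoverPair (stab f) (inject₁ a) (inject₁ b) → IsCoverPair f a b
coverPair-stab⁻ {f = f} (a<b , fa<fb , gap) = inject₁-cancel-< a<b , stab-cancel-< f fa<fb , λ c a<c c<b (p , q) →
  gap (inject₁ c) (inject₁-mono-< a<c) (inject₁-mono-< c<b) (stab-mono-< f p , stab-mono-< f q)

covers-stab⁺ : {σ : Fin (suc n) → Fin (suc n)} {τ f : Fin n → Fin n} →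
               Covers τ f → σ ≗ stab τ → Covers σ (stab f)
covers-stab⁺ {f = f} (a , b , a<b , fa<fb , gap , τ≗) σ≗ with coverPair-stab⁺ {f = f} (a<b , fa<fb , gap)
... | a<b′ , fa<fb′ , gap′ = inject₁ a , inject₁ b , a<b′ , fa<fb′ , gap′ ,
  λ k → trans (σ≗ k) (trans (stab-cong τ≗ k) (stab-∘-transpose f a b k))

covers-stab⁻ : {σ : Fin (suc n) → Fin (suc n)} {f : Fin n → Fin n} → Covers σ (stab f) →
               (∃[ a ] ∃[ b ] IsCoverPair f a b × σ ≗ stab (f ∘ transpose a b))
               ⊎ (∃[ a ] IsCoverPair (stab f) (inject₁ a) (fromℕ n) × σ ≗ stab f ∘ transpose (inject₁ a) (fromℕ n))
covers-stab⁻ {f = f} (a , b , a<b , pair) with inject₁-or-fromℕ a | inject₁-or-fromℕ b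
... | inj₁ (a′ , refl) | inj₁ (b′ , refl) = let (fa<fb , gap , σ≗) = pair in
  inj₁ (a′ , b′ , coverPair-stab⁻ (a<b , fa<fb , gap) , λ k → trans (σ≗ k) (sym (stab-∘-transpose f a′ b′ k)))
... | inj₁ (a′ , refl) | inj₂ refl = let (fa<fb , gap , σ≗) = pair in inj₂ (a′ , (a<b , fa<fb , gap) , σ≗)
... | inj₂ refl | inj₁ (b′ , refl) = contradiction a<b (ℕ.<-asym (inject₁<fromℕ b′))
... | inj₂ refl | inj₂ refl = contradiction a<b (ℕ.<-irrefl refl)

descending-after⇒≤ : ∀ {m} {f : Fin n → Fin m} → Injective _≡_ _≡_ f → (i : Fin n) →
                     (∀ c → i < c → f c < f i) → n ℕ.∸ suc (toℕ i) ≤ toℕ (f i)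
descending-after⇒≤ {n} {f = f} f-inj i desc = injective⇒≤ below-injective
  where
  s : ℕ
  s = suc (toℕ i)
  after-< : (j : Fin (n ℕ.∸ s)) → s + toℕ j ℕ.< n
  after-< j = subst₂ ℕ._≤_ (cong suc (ℕ.+-comm (toℕ j) s)) refl (ℕ.m≤o∸n⇒m+n≤o (suc (toℕ j)) (toℕ<n i) (toℕ<n j))
  after : Fin (n ℕ.∸ s) → Fin n
  after j = fromℕ< (after-< j)
  i<after : ∀ j → i < after j
  i<after j = subst₂ ℕ._<_ refl (sym (toℕ-fromℕ< (after-< j))) (ℕ.m≤m+n s (toℕ j))
  below : Fin (n ℕ.∸ s) → Fin (toℕ (f i))
  below j = fromℕ< (desc (after j) (i<after j))
  below-injective : Injective _≡_ _≡_ below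
  below-injective eq = toℕ-injective (ℕ.+-cancelˡ-≡ s _ _ (fromℕ<-injective _ _ _ _
    (f-inj (toℕ-injective (fromℕ<-injective _ _ _ _ eq)))))

coverPair-last⇒descending-after : {f : Fin n → Fin n} → Injective _≡_ _≡_ f → {i : Fin n} →
                                  IsCoverPair (stab f) (inject₁ i) (fromℕ n) → ∀ c → i < c → f c < f i
coverPair-last⇒descending-after {n} {f} f-inj {i} (_ , _ , gap) c i<c with <-cmp (f c) (f i)
... | tri< fc<fi _ _ = fc<fi
... | tri≈ _ fc≡fi _ = contradiction (cong toℕ (f-inj fc≡fi)) (ℕ.<⇒≢ i<c ∘ sym)
... | tri> _ _ fi<fc = contradiction (stab-mono-< f fi<fc , fc<last)
                                    (gap (inject₁ c) (inject₁-mono-< i<c) (inject₁<fromℕ c))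
  where
  fc<last : stab f (inject₁ c) < stab f (fromℕ n)
  fc<last = subst₂ _<_ (sym (stab-inject₁ f c)) (sym (stab-fromℕ f)) (inject₁<fromℕ (f c))

room⇒¬coverPair-last : {f : Fin n → Fin n} → Injective _≡_ _≡_ f → (i : Fin n) →
                       suc (toℕ i) + suc (toℕ (f i)) ≤ n → ¬ IsCoverPair (stab f) (inject₁ i) (fromℕ n)
room⇒¬coverPair-last {n} {f} f-inj i room pair = ℕ.≤⇒≯ (descending-after⇒≤ f-inj i desc) fi<n∸s
  where
  desc : ∀ c → i < c → f c < f i
  desc = coverPair-last⇒descending-after f-inj pair
  fi<n∸s : toℕ (f i) ℕ.< n ℕ.∸ suc (toℕ i)
  fi<n∸s = ℕ.m+n≤o⇒m≤o∸n (suc (toℕ (f i))) (subst₂ ℕ._≤_ (ℕ.+-comm (suc (toℕ i)) _) refl room)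

lemma4p5 : (n : ℕ) (π : Permutation′ n) →
    ¬ (∀ k → π ⟨$⟩ʳ k ≡ opposite k) →
    (i : Fin n) →
    suc (toℕ i) + suc (toℕ (π ⟨$⟩ʳ i)) ≤ n →
    (∀ c → c < i → π ⟨$⟩ʳ c > π ⟨$⟩ʳ i) →
    (σ : Permutation′ (suc n)) →
    ((Covers (σ ⟨$⟩ʳ_) (stab (π ⟨$⟩ʳ_)) × σ ⟨$⟩ʳ inject₁ i ≢ stab (π ⟨$⟩ʳ_) (inject₁ i))
      ⇔ (∃[ τ ] (Covers (τ ⟨$⟩ʳ_) (π ⟨$⟩ʳ_) × τ ⟨$⟩ʳ i ≢ π ⟨$⟩ʳ i
               × (∀ k → σ ⟨$⟩ʳ k ≡ stab (τ ⟨$⟩ʳ_) k))))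
lemma4p5 n π _ i room _ σ = mk⇔ unstabilize stabilize
  where
  ρ : Fin (suc n) → Fin (suc n)
  ρ = stab (π ⟨$⟩ʳ_)

  CoTransitionTermOfρ CoTransitionTermOfπ : Set
  CoTransitionTermOfρ = Covers (σ ⟨$⟩ʳ_) ρ × σ ⟨$⟩ʳ inject₁ i ≢ ρ (inject₁ i)
  CoTransitionTermOfπ = ∃[ τ ] (Covers (τ ⟨$⟩ʳ_) (π ⟨$⟩ʳ_) × τ ⟨$⟩ʳ i ≢ π ⟨$⟩ʳ i
                               × (∀ k → σ ⟨$⟩ʳ k ≡ stab (τ ⟨$⟩ʳ_) k))

  stabilize : CoTransitionTermOfπ → CoTransitionTermOfρ
  stabilize (τ , τ⋗π , τi≢πi , σ≗) = covers-stab⁺ τ⋗π σ≗ , λ σi≡ρi →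
    τi≢πi (inject₁-injective (trans (sym (≗stab-inject₁ σ≗ i)) (trans σi≡ρi (stab-inject₁ _ i))))

  unstabilize : CoTransitionTermOfρ → CoTransitionTermOfπ
  unstabilize (σ⋗ρ , σi≢ρi) with covers-stab⁻ σ⋗ρ
  ... | inj₁ (a , b , (a<b , πa<πb , gap) , σ≗) =
    Perm.transpose a b Perm.∘ₚ π , (a , b , a<b , πa<πb , gap , λ _ → refl) , τi≢πi , σ≗
    where
    τi≢πi : π ⟨$⟩ʳ transpose a b i ≢ π ⟨$⟩ʳ i
    τi≢πi τi≡πi = σi≢ρi (trans (≗stab-inject₁ σ≗ i) (trans (cong inject₁ τi≡πi) (sym (stab-inject₁ _ i))))
  ... | inj₂ (a , pair , σ≗) with a ≟ i
  ...   | yes refl = contradiction pair (room⇒¬coverPair-last (⟨$⟩ʳ-injective π) i room)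
  ...   | no  a≢i  = contradiction (trans (σ≗ (inject₁ i)) (cong ρ i-fixed)) σi≢ρi
    where
    i-fixed : transpose (inject₁ a) (fromℕ n) (inject₁ i) ≡ inject₁ i
    i-fixed = transpose-fixes _ _ _ (a≢i ∘ sym ∘ inject₁-injective) (fromℕ≢inject₁ ∘ sym)
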